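{- Let $d\geq 0$ and $k\geq 1$ be integers. Every graph $G$ with $\operatorname{mad}(G)<\frac{2d+2}{d+2}\, k$ is $k$-choosable with defect $d$.
   Context: Graphs are finite and simple. The maximum average degree $\operatorname{mad}(G)$ of a graph $G$ is the maximum, over all subgraphs $H$ of $G$, of the average degree of $H$. A colouring of $G$ assigns a colour to each vertex; the monochromatic subgraph is the spanning subgraph consisting of the edges whose endpoints receive the same colour. A colouring has defect $d$ if the monochromatic subgraph has maximum degree at most $d$. A list-assignment $L$ assigns a set $L(v)$ of colours to each vertex $v$; it is a $k$-list-assignment if $|L(v)|\geq k$ for every $v$. An $L$-colouring is a colouring in which each vertex $v$ receives a colour from $L(v)$. $G$ is $k$-choosable with defect $d$ if for every $k$-list-assignment $L$ of $G$, $G$ has an $L$-colouring with defect $d$. -}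

module Defs where

open import Data.Nat using (ℕ; zero; suc; _+_; _*_; _≤_; _≥_)
open import Data.Nat.Properties using (_≟_)
open import Data.Bool using (Bool; true; false; _∧_; if_then_else_; T)
open import Data.Fin using (Fin; zero; suc)
open import Data.List using (List; length)
open import Data.List.Membership.Propositional using (_∈_)
open import Data.List.Relation.Unary.Unique.Propositional using (Unique)
open import Data.Integer using (+_)
open import Data.Rational.Unnormalised using (ℚᵘ; mkℚᵘ; _<_)
open import Relation.Binary.PropositionalEquality using (_≡_)
open import Relation.Nullary.Decidable using (⌊_⌋)
open import Data.Product using (Σ; _×_)

record Graph (n : ℕ) : Set where
  field
    adj    : Fin n → Fin n → Bool
    sym    : ∀ u v → adj u v ≡ adj v u
    irrefl : ∀ v → adj v v ≡ false
open Graph public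

count : ∀ {n} → (Fin n → Bool) → ℕ
count {zero}  p = 0
count {suc n} p = (if p zero then 1 else 0) + count (λ i → p (suc i))

sumF : ∀ {n} → (Fin n → ℕ) → ℕ
sumF {zero}  f = 0
sumF {suc n} f = f zero + sumF (λ i → f (suc i))

record Subgraph {n : ℕ} (G : Graph n) : Set where
  field
    S       : Fin n → Bool
    F       : Fin n → Fin n → Bool
    F-sym   : ∀ u v → F u v ≡ F v u
    F⊆E     : ∀ u v → T (F u v) → T (adj G u v)
    F⊆S     : ∀ u v → T (F u v) → T (S u)
open Subgraph public

degH : ∀ {n} {G : Graph n} → Subgraph G → Fin n → ℕ
degH H v = count (λ u → F H v u)

orderH : ∀ {n} {G : Graph n} → Subgraph G → ℕ
orderH H = count (S H)

avgDeg : ∀ {n} {G : Graph n} (H : Subgraph G) (m : ℕ) → orderH H ≡ suc m → ℚᵘ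
avgDeg H m _ = mkℚᵘ (+ sumF (λ v → if S H v then degH H v else 0)) m

madLessThan : ∀ {n} → Graph n → ℚᵘ → Set
madLessThan G r = ∀ (H : Subgraph G) (m : ℕ) (e : orderH H ≡ suc m) → avgDeg H m e < r

ListAssignment : ℕ → ℕ → Set
ListAssignment n k = Σ (Fin n → List ℕ) (λ L → ∀ v → Unique (L v) × length (L v) ≥ k)

monoDeg : ∀ {n} → Graph n → (Fin n → ℕ) → Fin n → ℕ
monoDeg G c v = count (λ u → adj G v u ∧ ⌊ c u ≟ c v ⌋)

IsLColouringDefect : ∀ {n} → Graph n → (Fin n → List ℕ) → ℕ → (Fin n → ℕ) → Set
IsLColouringDefect G L d c = ∀ v → (c v ∈ L v) × (monoDeg G c v ≤ d)

ChoosableDefect : ∀ {n} → Graph n → ℕ → ℕ → Set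
ChoosableDefect {n} G k d =
  (L : ListAssignment n k) → Σ (Fin n → ℕ) (IsLColouringDefect G (Data.Product.proj₁ L) d)

module Submission where

-- Colour a vertex set U by induction on |U|. Call v light with respect to A ⊆ U if
-- deg_A(v) + (d + 1) deg_{U∖A}(v) < (d + 1) k. Deleting vertices of U that are not light one at a
-- time either stops at a nonempty set A of light vertices, or deletes all of U. In the latter case
-- (d + 2) e(A, A) + 2 (d + 1) e(A, U ∖ A), with e counting ordered adjacent pairs, drops by at least
-- 2 (d + 1) k per deleted vertex, so G[U] has average degree at least 2 (d + 1) k / (d + 2),
-- contradicting the bound on mad. Otherwise colour U ∖ A by induction and extend to A by local
-- search: a light vertex has a colour in its list used by no neighbour in U ∖ A and by at most d
-- neighbours in A (its list is too long for every colour to clash), and recolouring a vertex of A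
-- with such a colour strictly decreases the number of monochromatic edges inside A plus 2 (d + 1)
-- times the number of monochromatic edges from A to U ∖ A.

open import Algebra.Properties.CommutativeSemigroup using (interchange)
open import Data.Bool using (Bool; true; false; _∧_; not; if_then_else_; T)
open import Data.Bool.Properties using (T-∧; T-≡; T-not-≡; ∧-zeroʳ; ∧-identityʳ)
open import Data.Empty using (⊥-elim)
open import Data.Fin using (Fin; zero; suc)
open import Data.Fin.Properties using (any?) renaming (_≟_ to _≟ᶠ_)
import Data.Integer as ℤ
import Data.Integer.Properties as ℤ
open import Data.List using (List; []; _∷_; length; map)
open import Data.List.Membership.Propositional using (_∈_; find)
open import Data.List.Properties using (map-cong; map-cong-local)
open import Data.List.Relation.Unary.All as All using (All; []; _∷_)
open import Data.List.Relation.Unary.All.Properties using (¬Any⇒All¬)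
open import Data.List.Relation.Unary.AllPairs using ([]; _∷_)
open import Data.List.Relation.Unary.Any using (here) renaming (any? to anyᴸ?)
open import Data.List.Relation.Unary.Unique.Propositional using (Unique)
open import Data.Nat using (ℕ; zero; suc; _+_; _*_; _≤_; _<_; _≥_; z≤n; s≤s; s≤s⁻¹; _≟_; _≤?_; _<?_)
open import Data.Nat.ListAction using (sum)
open import Data.Nat.Properties
open import Data.Nat.Tactic.RingSolver using (solve-∀)
open import Data.Product using (∃; _×_; _,_; proj₁; proj₂)
open import Data.Rational.Unnormalised using (mkℚᵘ; *<*)
open import Data.Sum using (_⊎_; inj₁; inj₂)
open import Data.Vec.Functional using (updateAt)
open import Data.Vec.Functional.Properties using (updateAt-updates; updateAt-minimal)
open import Function using (_∘_; const; Equivalence)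
open import Relation.Binary.PropositionalEquality
open import Relation.Nullary using (¬_; yes; no; does)
open import Relation.Nullary.Decidable using (⌊_⌋; T?; _×-dec_)

open import Defs hiding (sym)

𝟙 : Bool → ℕ
𝟙 b = if b then 1 else 0

𝟙-∧ : ∀ a b → 𝟙 (a ∧ b) ≡ 𝟙 a * 𝟙 b
𝟙-∧ false b = refl
𝟙-∧ true  b = sym (+-identityʳ (𝟙 b))

count≡sumF-𝟙 : ∀ {n} (p : Fin n → Bool) → count p ≡ sumF (𝟙 ∘ p)
count≡sumF-𝟙 {zero}  p = refl
count≡sumF-𝟙 {suc n} p = cong (𝟙 (p zero) +_) (count≡sumF-𝟙 (p ∘ suc))

sumF-cong : ∀ {n} {f g : Fin n → ℕ} → (∀ i → f i ≡ g i) → sumF f ≡ sumF g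
sumF-cong {zero}  f≗g = refl
sumF-cong {suc n} f≗g = cong₂ _+_ (f≗g zero) (sumF-cong (f≗g ∘ suc))

sumF-mono : ∀ {n} {f g : Fin n → ℕ} → (∀ i → f i ≤ g i) → sumF f ≤ sumF g
sumF-mono {zero}  f≤g = z≤n
sumF-mono {suc n} f≤g = +-mono-≤ (f≤g zero) (sumF-mono (f≤g ∘ suc))

sumF-zero : ∀ {n} → sumF {n} (const 0) ≡ 0
sumF-zero {zero}  = refl
sumF-zero {suc n} = sumF-zero {n}

sumF-+ : ∀ {n} (f g : Fin n → ℕ) → sumF (λ i → f i + g i) ≡ sumF f + sumF g
sumF-+ {zero}  f g = refl
sumF-+ {suc n} f g = trans (cong (f zero + g zero +_) (sumF-+ (f ∘ suc) (g ∘ suc)))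
                           (interchange +-commutativeSemigroup (f zero) (g zero) _ _)

sumF-*ˡ : ∀ {n} a (f : Fin n → ℕ) → sumF (λ i → a * f i) ≡ a * sumF f
sumF-*ˡ {zero}  a f = sym (*-zeroʳ a)
sumF-*ˡ {suc n} a f = trans (cong (a * f zero +_) (sumF-*ˡ a (f ∘ suc))) (sym (*-distribˡ-+ a (f zero) _))

sumF-swap : ∀ {m n} (F : Fin m → Fin n → ℕ) →
  sumF (λ i → sumF (F i)) ≡ sumF (λ j → sumF (λ i → F i j))
sumF-swap {zero} {n} F = sym (sumF-zero {n})
sumF-swap {suc m} F = trans (cong (sumF (F zero) +_) (sumF-swap (F ∘ suc)))
                            (sym (sumF-+ (F zero) _))

δ : ∀ {n} → Fin n → Fin n → ℕ
δ v i = 𝟙 (does (v ≟ᶠ i))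

sumF-δ : ∀ {n} (v : Fin n) (f : Fin n → ℕ) → sumF (λ i → δ v i * f i) ≡ f v
sumF-δ {suc n} zero    f = trans (cong₂ _+_ (+-identityʳ (f zero)) (sumF-zero {n})) (+-identityʳ (f zero))
sumF-δ {suc n} (suc v) f = sumF-δ v (f ∘ suc)

*-length≤sum : ∀ {a} (f : ℕ → ℕ) {xs} → All (λ x → a ≤ f x) xs → a * length xs ≤ sum (map f xs)
*-length≤sum {a} f []              = ≤-reflexive (*-zeroʳ a)
*-length≤sum {a} f (a≤fx ∷ a≤fxs) =
  ≤-trans (≤-reflexive (*-suc a _)) (+-mono-≤ a≤fx (*-length≤sum f a≤fxs))

term≤sumF : ∀ {n} (f : Fin n → ℕ) i → f i ≤ sumF f
term≤sumF f zero    = m≤m+n (f zero) _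
term≤sumF f (suc i) = ≤-trans (term≤sumF (f ∘ suc) i) (m≤n+m _ (f zero))

count-pos : ∀ {n} (p : Fin n → Bool) v → T (p v) → 1 ≤ count p
count-pos p v pv = begin
  1                ≡⟨ cong 𝟙 (sym (Equivalence.to T-≡ pv)) ⟩
  𝟙 (p v)          ≤⟨ term≤sumF (𝟙 ∘ p) v ⟩
  sumF (𝟙 ∘ p)     ≡⟨ sym (count≡sumF-𝟙 p) ⟩
  count p ∎
  where open ≤-Reasoning

count≡0⇒¬T : ∀ {n} (p : Fin n → Bool) → count p ≡ 0 → ∀ v → ¬ T (p v)
count≡0⇒¬T p |p|≡0 v pv = <-irrefl refl (≤-trans (count-pos p v pv) (≤-reflexive |p|≡0))

¬T⇒count≡0 : ∀ {n} (p : Fin n → Bool) → (∀ v → ¬ T (p v)) → count p ≡ 0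
¬T⇒count≡0 {n} p ¬p = trans (count≡sumF-𝟙 p) (trans (sumF-cong 𝟙-p≡0) (sumF-zero {n}))
  where
  𝟙-p≡0 : ∀ v → 𝟙 (p v) ≡ 0
  𝟙-p≡0 v with p v in pv
  ... | false = refl
  ... | true  = ⊥-elim (¬p v (Equivalence.from T-≡ pv))

updateAt-preserves : ∀ {n} (P : Fin n → ℕ → Set) (c : Fin n → ℕ) v β →
  P v β → (∀ w → P w (c w)) → ∀ w → P w (updateAt c v (const β) w)
updateAt-preserves P c v β Pvβ Pc w with w ≟ᶠ v
... | yes refl = subst (P v) (sym (updateAt-updates v c)) Pvβ
... | no  w≢v  = subst (P w) (sym (updateAt-minimal w v c w≢v)) (Pc w)

≟-sym : ∀ (x y : ℕ) → ⌊ x ≟ y ⌋ ≡ ⌊ y ≟ x ⌋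
≟-sym x y with x ≟ y | y ≟ x
... | yes _   | yes _  = refl
... | no _    | no _   = refl
... | yes x≡y | no y≢x = ⊥-elim (y≢x (sym x≡y))
... | no x≢y  | yes y≡x = ⊥-elim (x≢y (sym y≡x))

𝟙-split : ∀ b x → 𝟙 b * x + 𝟙 (not b) * x ≡ x
𝟙-split false x = +-identityʳ x
𝟙-split true  x = trans (+-identityʳ (x + 0)) (+-identityʳ x)

restrictTo : ∀ {n} → (Fin n → ℕ) → ℕ → (Fin n → ℕ) → Fin n → ℕ
restrictTo c x f w = 𝟙 ⌊ c w ≟ x ⌋ * f w

sum-restrictTo-≤ : ∀ {n} (c f : Fin n → ℕ) (xs : List ℕ) → Unique xs →
  sum (map (λ x → sumF (restrictTo c x f)) xs) ≤ sumF f
sum-restrictTo-≤ c f []       _            = z≤n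
sum-restrictTo-≤ {n} c f (x ∷ xs) (x∉xs ∷ !xs) = begin
  sumF (restrictTo c x f) + sum (map (λ y → sumF (restrictTo c y f)) xs)
    ≡⟨ cong (λ s → sumF (restrictTo c x f) + sum s) (map-cong-local (All.map other-class x∉xs)) ⟩
  sumF (restrictTo c x f) + sum (map (λ y → sumF (restrictTo c y f′)) xs)
    ≤⟨ +-monoʳ-≤ _ (sum-restrictTo-≤ c f′ xs !xs) ⟩
  sumF (restrictTo c x f) + sumF f′
    ≡⟨ sym (sumF-+ (restrictTo c x f) f′) ⟩
  sumF (λ w → 𝟙 ⌊ c w ≟ x ⌋ * f w + 𝟙 (not ⌊ c w ≟ x ⌋) * f w)
    ≡⟨ sumF-cong (λ w → 𝟙-split ⌊ c w ≟ x ⌋ (f w)) ⟩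
  sumF f ∎
  where
  open ≤-Reasoning
  f′ : Fin n → ℕ
  f′ w = 𝟙 (not ⌊ c w ≟ x ⌋) * f w
  other-class : ∀ {y} → x ≢ y → sumF (restrictTo c y f) ≡ sumF (restrictTo c y f′)
  other-class {y} x≢y = sumF-cong pointwise
    where
    pointwise : ∀ w → restrictTo c y f w ≡ restrictTo c y f′ w
    pointwise w with c w ≟ y | c w ≟ x
    ... | no _     | _        = refl
    ... | yes refl | yes refl = ⊥-elim (x≢y refl)
    ... | yes refl | no _     = cong (_+ 0) (sym (+-identityʳ (f w)))

sumF² : ∀ {n} → (Fin n → Fin n → ℕ) → ℕ
sumF² F = sumF λ u → sumF (F u)

sumF²-+ : ∀ {n} (F H : Fin n → Fin n → ℕ) → sumF² (λ u w → F u w + H u w) ≡ sumF² F + sumF² H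
sumF²-+ F H = trans (sumF-cong (λ u → sumF-+ (F u) (H u))) (sumF-+ (λ u → sumF (F u)) (λ u → sumF (H u)))

pairSum : ∀ {n} → (Fin n → Fin n → ℕ) → (Fin n → ℕ) → ℕ
pairSum F c = sumF² λ u w → F u w * 𝟙 ⌊ c u ≟ c w ⌋

pairSumAt : ∀ {n} → (Fin n → Fin n → ℕ) → (Fin n → ℕ) → Fin n → ℕ → ℕ
pairSumAt F c v x = sumF λ w → (F v w + F w v) * 𝟙 ⌊ c w ≟ x ⌋

pairSum-updateAt : ∀ {n} (F : Fin n → Fin n → ℕ) (c : Fin n → ℕ) v β → F v v ≡ 0 →
  pairSum F (updateAt c v (const β)) + pairSumAt F c v (c v) ≡ pairSum F c + pairSumAt F c v β
pairSum-updateAt {n} F c v β Fvv≡0 = begin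
  pairSum F c′ + pairSumAt F c v α     ≡⟨ cong (pairSum F c′ +_) (sym (at α)) ⟩
  pairSum F c′ + sumF² (atTerms α)    ≡⟨ sym (sumF²-+ _ (atTerms α)) ⟩
  sumF² (λ u w → same c′ u w + atTerms α u w)
    ≡⟨ sumF-cong (λ u → sumF-cong (λ w → pointwise u w)) ⟩
  sumF² (λ u w → same c u w + atTerms β u w)
    ≡⟨ sumF²-+ _ (atTerms β) ⟩
  pairSum F c + sumF² (atTerms β)     ≡⟨ cong (pairSum F c +_) (at β) ⟩
  pairSum F c + pairSumAt F c v β ∎
  where
  open ≡-Reasoning
  α : ℕ
  α = c v
  c′ : Fin n → ℕ
  c′ = updateAt c v (const β)
  same : (Fin n → ℕ) → Fin n → Fin n → ℕ
  same γ u w = F u w * 𝟙 ⌊ γ u ≟ γ w ⌋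
  atTerms : ℕ → Fin n → Fin n → ℕ
  atTerms x u w = δ v u * (F u w * 𝟙 ⌊ c w ≟ x ⌋) + δ v w * (F u w * 𝟙 ⌊ c u ≟ x ⌋)

  at : ∀ x → sumF² (atTerms x) ≡ pairSumAt F c v x
  at x = begin
    sumF² (atTerms x)
      ≡⟨ sumF²-+ (λ u w → δ v u * X u w) (λ u w → δ v w * Y u w) ⟩
    sumF² (λ u w → δ v u * X u w) + sumF² (λ u w → δ v w * Y u w)
      ≡⟨ cong₂ _+_ (trans (sumF-cong (λ u → sumF-*ˡ (δ v u) (X u))) (sumF-δ v (λ u → sumF (X u))))
                   (sumF-cong (λ u → sumF-δ v (Y u))) ⟩
    sumF (X v) + sumF (λ w → Y w v)
      ≡⟨ sym (sumF-+ (X v) (λ w → Y w v)) ⟩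
    sumF (λ w → F v w * 𝟙 ⌊ c w ≟ x ⌋ + F w v * 𝟙 ⌊ c w ≟ x ⌋)
      ≡⟨ sumF-cong (λ w → sym (*-distribʳ-+ (𝟙 ⌊ c w ≟ x ⌋) (F v w) (F w v))) ⟩
    pairSumAt F c v x ∎
    where
    X Y : Fin n → Fin n → ℕ
    X u w = F u w * 𝟙 ⌊ c w ≟ x ⌋
    Y u w = F u w * 𝟙 ⌊ c u ≟ x ⌋

  exchangeˡ : ∀ a b → a + (b + 0 + 0) ≡ b + (a + 0 + 0)
  exchangeˡ = solve-∀

  exchangeʳ : ∀ a b → a + (b + 0) ≡ b + (a + 0)
  exchangeʳ = solve-∀

  pointwise : ∀ u w → same c′ u w + atTerms α u w ≡ same c u w + atTerms β u w
  pointwise u w with v ≟ᶠ u | v ≟ᶠ w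
  ... | yes refl | yes refl rewrite Fvv≡0 = refl
  ... | yes refl | no v≢w
    rewrite updateAt-updates v {const β} c | updateAt-minimal w v {const β} c (v≢w ∘ sym)
          | ≟-sym β (c w) | ≟-sym (c w) (c v)
          = exchangeˡ (F v w * 𝟙 ⌊ c w ≟ β ⌋) (F v w * 𝟙 ⌊ c v ≟ c w ⌋)
  ... | no v≢u   | yes refl
    rewrite updateAt-updates v {const β} c | updateAt-minimal u v {const β} c (v≢u ∘ sym)
          = exchangeʳ (F u v * 𝟙 ⌊ c u ≟ β ⌋) (F u v * 𝟙 ⌊ c u ≟ c v ⌋)
  ... | no v≢u   | no v≢w
    rewrite updateAt-minimal u v {const β} c (v≢u ∘ sym)
          | updateAt-minimal w v {const β} c (v≢w ∘ sym) = refl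

VSet : ℕ → Set
VSet n = Fin n → Bool

_∖_ : ∀ {n} → VSet n → VSet n → VSet n
(U ∖ A) w = U w ∧ not (A w)

_-_ : ∀ {n} → VSet n → Fin n → VSet n
(A - v) w = A w ∧ not (does (v ≟ᶠ w))

𝟙-remove : ∀ {n} (A : VSet n) v → A v ≡ true → ∀ w → 𝟙 (A w) ≡ 𝟙 ((A - v) w) + δ v w
𝟙-remove A v Av w with v ≟ᶠ w
... | yes refl rewrite Av = refl
... | no  _    rewrite ∧-identityʳ (A w) = sym (+-identityʳ _)

𝟙-∖-remove : ∀ {n} (U A : VSet n) v → U v ≡ true → A v ≡ true →
  ∀ w → 𝟙 ((U ∖ (A - v)) w) ≡ 𝟙 ((U ∖ A) w) + δ v w
𝟙-∖-remove U A v Uv Av w with v ≟ᶠ w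
... | yes refl rewrite Uv | Av = refl
... | no  _    rewrite ∧-identityʳ (A w) = sym (+-identityʳ _)

count-remove : ∀ {n} (A : VSet n) v → A v ≡ true → count A ≡ suc (count (A - v))
count-remove {n} A v Av = begin
  count A                             ≡⟨ count≡sumF-𝟙 A ⟩
  sumF (𝟙 ∘ A)                        ≡⟨ sumF-cong (𝟙-remove A v Av) ⟩
  sumF (λ w → 𝟙 ((A - v) w) + δ v w)  ≡⟨ sumF-+ (𝟙 ∘ (A - v)) (δ v) ⟩
  sumF (𝟙 ∘ (A - v)) + sumF (δ v)     ≡⟨ cong₂ _+_ (sym (count≡sumF-𝟙 (A - v))) sumF-δv≡1 ⟩
  count (A - v) + 1                   ≡⟨ +-comm (count (A - v)) 1 ⟩
  suc (count (A - v)) ∎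
  where
  open ≡-Reasoning
  sumF-δv≡1 : sumF (δ v) ≡ 1
  sumF-δv≡1 = trans (sumF-cong (λ w → sym (*-identityʳ (δ v w)))) (sumF-δ v (const 1))

count-∖ : ∀ {n} (U A : VSet n) → (∀ w → T (A w) → T (U w)) → count U ≡ count (U ∖ A) + count A
count-∖ U A A⊆U = begin
  count U                               ≡⟨ count≡sumF-𝟙 U ⟩
  sumF (𝟙 ∘ U)                          ≡⟨ sumF-cong split ⟩
  sumF (λ w → 𝟙 ((U ∖ A) w) + 𝟙 (A w))  ≡⟨ sumF-+ (𝟙 ∘ (U ∖ A)) (𝟙 ∘ A) ⟩
  sumF (𝟙 ∘ (U ∖ A)) + sumF (𝟙 ∘ A)     ≡⟨ sym (cong₂ _+_ (count≡sumF-𝟙 (U ∖ A)) (count≡sumF-𝟙 A)) ⟩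
  count (U ∖ A) + count A ∎
  where
  open ≡-Reasoning
  split : ∀ w → 𝟙 (U w) ≡ 𝟙 ((U ∖ A) w) + 𝟙 (A w)
  split w with A w in Aw | U w in Uw
  ... | false | false = refl
  ... | false | true  = refl
  ... | true  | true  = refl
  ... | true  | false with () ← trans (sym (Equivalence.to T-≡ (A⊆U w (Equivalence.from T-≡ Aw)))) Uw

module _ {n : ℕ} (G : Graph n) where

  edge : Fin n → Fin n → ℕ
  edge u w = 𝟙 (adj G u w)

  deg : (Fin n → ℕ) → Fin n → ℕ
  deg f v = sumF λ w → edge v w * f w

  deg-cong : ∀ {f g} v → (∀ w → f w ≡ g w) → deg f v ≡ deg g v
  deg-cong v f≗g = sumF-cong (λ w → cong (edge v w *_) (f≗g w))

  deg-mono : ∀ {f g} v → (∀ w → T (adj G v w) → f w ≤ g w) → deg f v ≤ deg g v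
  deg-mono {f} {g} v f≤g = sumF-mono pointwise
    where
    pointwise : ∀ w → edge v w * f w ≤ edge v w * g w
    pointwise w with adj G v w in vw
    ... | false = z≤n
    ... | true  = +-monoˡ-≤ 0 (f≤g w (Equivalence.from T-≡ vw))

  deg-+ : ∀ f g v → deg (λ w → f w + g w) v ≡ deg f v + deg g v
  deg-+ f g v = trans (sumF-cong (λ w → *-distribˡ-+ (edge v w) (f w) (g w)))
                      (sumF-+ (λ w → edge v w * f w) (λ w → edge v w * g w))

  deg-*ˡ : ∀ a f v → deg (λ w → a * f w) v ≡ a * deg f v
  deg-*ˡ a f v = trans (sumF-cong (λ w → x*[y*z]≡y*[x*z] (edge v w) a (f w)))
                       (sumF-*ˡ a (λ w → edge v w * f w))
    where
    x*[y*z]≡y*[x*z] : ∀ x y z → x * (y * z) ≡ y * (x * z)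
    x*[y*z]≡y*[x*z] = solve-∀

  deg-δ : ∀ u v → deg (δ v) u ≡ edge u v
  deg-δ u v = trans (sumF-cong (λ w → *-comm (edge u w) (δ v w))) (sumF-δ v (edge u))

  count≡deg : ∀ v (p : Fin n → Bool) → count (λ w → adj G v w ∧ p w) ≡ deg (𝟙 ∘ p) v
  count≡deg v p = trans (count≡sumF-𝟙 (λ w → adj G v w ∧ p w))
                        (sumF-cong (λ w → 𝟙-∧ (adj G v w) (p w)))

  ⟨_,_⟩ : (Fin n → ℕ) → (Fin n → ℕ) → ℕ
  ⟨ f , g ⟩ = sumF λ u → f u * deg g u

  ⟨⟩-cong : ∀ {f f′ g g′} → (∀ u → f u ≡ f′ u) → (∀ w → g w ≡ g′ w) → ⟨ f , g ⟩ ≡ ⟨ f′ , g′ ⟩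
  ⟨⟩-cong f≗f′ g≗g′ = sumF-cong (λ u → cong₂ _*_ (f≗f′ u) (deg-cong u g≗g′))

  ⟨⟩-expand : ∀ f g → ⟨ f , g ⟩ ≡ sumF² λ u w → f u * (edge u w * g w)
  ⟨⟩-expand f g = sumF-cong (λ u → sym (sumF-*ˡ (f u) (λ w → edge u w * g w)))

  ⟨⟩-comm : ∀ f g → ⟨ f , g ⟩ ≡ ⟨ g , f ⟩
  ⟨⟩-comm f g = begin
    ⟨ f , g ⟩                                 ≡⟨ ⟨⟩-expand f g ⟩
    sumF² (λ u w → f u * (edge u w * g w))    ≡⟨ sumF-swap (λ u w → f u * (edge u w * g w)) ⟩
    sumF² (λ w u → f u * (edge u w * g w))    ≡⟨ sumF-cong (λ w → sumF-cong (λ u → mirror w u)) ⟩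
    sumF² (λ w u → g w * (edge w u * f u))    ≡⟨ sym (⟨⟩-expand g f) ⟩
    ⟨ g , f ⟩ ∎
    where
    open ≡-Reasoning
    x*[y*z]≡z*[y*x] : ∀ x y z → x * (y * z) ≡ z * (y * x)
    x*[y*z]≡z*[y*x] = solve-∀
    mirror : ∀ w u → f u * (edge u w * g w) ≡ g w * (edge w u * f u)
    mirror w u = trans (x*[y*z]≡z*[y*x] (f u) (edge u w) (g w))
                       (cong (λ e → g w * (𝟙 e * f u)) (Graph.sym G u w))

  ⟨⟩-+ˡ : ∀ f₁ f₂ g → ⟨ (λ u → f₁ u + f₂ u) , g ⟩ ≡ ⟨ f₁ , g ⟩ + ⟨ f₂ , g ⟩
  ⟨⟩-+ˡ f₁ f₂ g = trans (sumF-cong (λ u → *-distribʳ-+ (deg g u) (f₁ u) (f₂ u)))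
                        (sumF-+ (λ u → f₁ u * deg g u) (λ u → f₂ u * deg g u))

  ⟨⟩-+ʳ : ∀ f g₁ g₂ → ⟨ f , (λ w → g₁ w + g₂ w) ⟩ ≡ ⟨ f , g₁ ⟩ + ⟨ f , g₂ ⟩
  ⟨⟩-+ʳ f g₁ g₂ = trans (⟨⟩-comm f _)
                 (trans (⟨⟩-+ˡ g₁ g₂ f) (cong₂ _+_ (⟨⟩-comm g₁ f) (⟨⟩-comm g₂ f)))

  ⟨δ,_⟩ : ∀ g {v} → ⟨ δ v , g ⟩ ≡ deg g v
  ⟨δ, g ⟩ {v} = sumF-δ v (deg g)

  ⟨_,δ⟩ : ∀ f {v} → ⟨ f , δ v ⟩ ≡ deg f v
  ⟨ f ,δ⟩ = trans (⟨⟩-comm f _) ⟨δ, f ⟩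

  ⟨⟩-δˡ : ∀ {f f′} v g → (∀ u → f u ≡ f′ u + δ v u) → ⟨ f , g ⟩ ≡ ⟨ f′ , g ⟩ + deg g v
  ⟨⟩-δˡ {f} {f′} v g f≡f′+δ = begin
    ⟨ f , g ⟩                          ≡⟨ ⟨⟩-cong {g = g} {g′ = g} f≡f′+δ (λ _ → refl) ⟩
    ⟨ (λ u → f′ u + δ v u) , g ⟩       ≡⟨ ⟨⟩-+ˡ f′ (δ v) g ⟩
    ⟨ f′ , g ⟩ + ⟨ δ v , g ⟩           ≡⟨ cong (⟨ f′ , g ⟩ +_) ⟨δ, g ⟩ ⟩
    ⟨ f′ , g ⟩ + deg g v ∎
    where open ≡-Reasoning

  ⟨⟩-δʳ : ∀ f {g g′} v → (∀ w → g w ≡ g′ w + δ v w) → ⟨ f , g ⟩ ≡ ⟨ f , g′ ⟩ + deg f v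
  ⟨⟩-δʳ f {g} {g′} v g≡g′+δ = begin
    ⟨ f , g ⟩                          ≡⟨ ⟨⟩-cong {f} {f} (λ _ → refl) g≡g′+δ ⟩
    ⟨ f , (λ w → g′ w + δ v w) ⟩       ≡⟨ ⟨⟩-+ʳ f g′ (δ v) ⟩
    ⟨ f , g′ ⟩ + ⟨ f , δ v ⟩           ≡⟨ cong (⟨ f , g′ ⟩ +_) ⟨ f ,δ⟩ ⟩
    ⟨ f , g′ ⟩ + deg f v ∎
    where open ≡-Reasoning

  deg-δ-self : ∀ {g g′} v → (∀ w → g w ≡ g′ w + δ v w) → deg g v ≡ deg g′ v
  deg-δ-self {g} {g′} v g≡g′+δ = begin
    deg g v                     ≡⟨ deg-cong v g≡g′+δ ⟩
    deg (λ w → g′ w + δ v w) v  ≡⟨ deg-+ g′ (δ v) v ⟩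
    deg g′ v + deg (δ v) v      ≡⟨ cong (deg g′ v +_) (trans (deg-δ v v) (cong 𝟙 (irrefl G v))) ⟩
    deg g′ v + 0                ≡⟨ +-identityʳ _ ⟩
    deg g′ v ∎
    where open ≡-Reasoning

  ⟨⟩-zeroʳ : ∀ f {g} → (∀ w → g w ≡ 0) → ⟨ f , g ⟩ ≡ 0
  ⟨⟩-zeroʳ f {g} g≗0 = trans (sumF-cong pointwise) (sumF-zero {n})
    where
    pointwise : ∀ u → f u * deg g u ≡ 0
    pointwise u = begin
      f u * deg g u                  ≡⟨ cong (f u *_) (deg-cong u g≗0) ⟩
      f u * deg (const 0) u          ≡⟨ cong (f u *_) (sumF-cong (λ w → *-zeroʳ (edge u w))) ⟩
      f u * sumF {n} (const 0)       ≡⟨ cong (f u *_) (sumF-zero {n}) ⟩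
      f u * 0                        ≡⟨ *-zeroʳ (f u) ⟩
      0 ∎
      where open ≡-Reasoning

  deg-restrictTo-≤ : ∀ c f v xs → Unique xs → sum (map (λ x → deg (restrictTo c x f) v) xs) ≤ deg f v
  deg-restrictTo-≤ c f v xs !xs = begin
    sum (map (λ x → deg (restrictTo c x f) v) xs)
      ≡⟨ cong sum (map-cong (λ x → sumF-cong (λ w → x*[y*z]≡y*[x*z] (edge v w) (𝟙 ⌊ c w ≟ x ⌋) (f w)))
                            xs) ⟩
    sum (map (λ x → sumF (restrictTo c x (λ w → edge v w * f w))) xs)
      ≤⟨ sum-restrictTo-≤ c (λ w → edge v w * f w) xs !xs ⟩
    deg f v ∎
    where
    open ≤-Reasoning
    x*[y*z]≡y*[x*z] : ∀ x y z → x * (y * z) ≡ y * (x * z)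
    x*[y*z]≡y*[x*z] = solve-∀

  induced : VSet n → Subgraph G
  induced U = record
    { S     = U
    ; F     = λ u w → U u ∧ (adj G u w ∧ U w)
    ; F-sym = symmetric
    ; F⊆E   = λ u w uw → proj₁ (Equivalence.to (T-∧ {adj G u w}) (proj₂ (Equivalence.to (T-∧ {U u}) uw)))
    ; F⊆S   = λ u w uw → proj₁ (Equivalence.to (T-∧ {U u}) uw)
    }
    where
    symmetric : ∀ u w → (U u ∧ (adj G u w ∧ U w)) ≡ (U w ∧ (adj G w u ∧ U u))
    symmetric u w with U u | U w
    ... | true  | true  = cong (_∧ true) (Graph.sym G u w)
    ... | true  | false = ∧-zeroʳ (adj G u w)
    ... | false | true  = sym (∧-zeroʳ (adj G w u))
    ... | false | false = refl

  degreeSum-induced : ∀ U → sumF (λ v → if U v then degH (induced U) v else 0) ≡ ⟨ 𝟙 ∘ U , 𝟙 ∘ U ⟩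
  degreeSum-induced U = sumF-cong pointwise
    where
    pointwise : ∀ v → (if U v then degH (induced U) v else 0) ≡ 𝟙 (U v) * deg (𝟙 ∘ U) v
    pointwise v with U v
    ... | false = refl
    ... | true  = trans (count≡deg v U) (sym (+-identityʳ _))

  module _ (d k : ℕ) (L : Fin n → List ℕ) (L-ok : ∀ v → Unique (L v) × length (L v) ≥ k) where

    colourDeg : VSet n → (Fin n → ℕ) → ℕ → Fin n → ℕ
    colourDeg P c x = deg (restrictTo c x (𝟙 ∘ P))

    monoDeg≡colourDeg : ∀ c v → monoDeg G c v ≡ colourDeg (const true) c (c v) v
    monoDeg≡colourDeg c v = trans (count≡deg v (λ u → ⌊ c u ≟ c v ⌋))
                                  (deg-cong v (λ w → sym (*-identityʳ (𝟙 ⌊ c w ≟ c v ⌋))))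

    GoodOn : VSet n → (Fin n → ℕ) → Set
    GoodOn U c = ∀ v → T (U v) → c v ∈ L v × colourDeg U c (c v) v ≤ d

    clashWeight : VSet n → VSet n → Fin n → ℕ
    clashWeight U A w = suc d * 𝟙 ((U ∖ A) w) + 𝟙 (A w)

    -- clash U A c v x ≤ d says that no neighbour of v in U ∖ A and at most d in A have colour x
    clash : VSet n → VSet n → (Fin n → ℕ) → Fin n → ℕ → ℕ
    clash U A c v x = deg (restrictTo c x (clashWeight U A)) v

    Light : VSet n → VSet n → Fin n → Set
    Light U A v = deg (clashWeight U A) v < suc d * k

    pickColour : ∀ U A c v → Light U A v → ∃ λ β → β ∈ L v × clash U A c v β ≤ d
    pickColour U A c v light with anyᴸ? (λ x → clash U A c v x ≤? d) (L v)
    ... | yes found = find found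
    ... | no  none  = ⊥-elim (<⇒≱ light (begin
      suc d * k                        ≤⟨ *-monoʳ-≤ (suc d) (proj₂ (L-ok v)) ⟩
      suc d * length (L v)
        ≤⟨ *-length≤sum (clash U A c v) (All.map ≰⇒> (¬Any⇒All¬ (L v) none)) ⟩
      sum (map (clash U A c v) (L v))  ≤⟨ deg-restrictTo-≤ c (clashWeight U A) v (L v) (proj₁ (L-ok v)) ⟩
      deg (clashWeight U A) v          ∎))
      where open ≤-Reasoning

    someColour : k ≥ 1 → ∀ v → ∃ (_∈ L v)
    someColour k≥1 v with L v | proj₂ (L-ok v)
    ... | x ∷ _ | _     = x , here refl
    ... | []    | k≤0   = ⊥-elim (<-irrefl refl (≤-trans k≥1 k≤0))

    deg-clashWeight : ∀ U A v → deg (clashWeight U A) v ≡ suc d * deg (𝟙 ∘ (U ∖ A)) v + deg (𝟙 ∘ A) v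
    deg-clashWeight U A v = trans (deg-+ (λ w → suc d * 𝟙 ((U ∖ A) w)) (𝟙 ∘ A) v)
                                  (cong (_+ deg (𝟙 ∘ A) v) (deg-*ˡ (suc d) (𝟙 ∘ (U ∖ A)) v))

    clash-split : ∀ U A c v x → clash U A c v x ≡ suc d * colourDeg (U ∖ A) c x v + colourDeg A c x v
    clash-split U A c v x = begin
      clash U A c v x
        ≡⟨ deg-cong v (λ w → distrib (𝟙 ⌊ c w ≟ x ⌋) (𝟙 ((U ∖ A) w)) (𝟙 (A w))) ⟩
      deg (λ w → suc d * restrictTo c x (𝟙 ∘ (U ∖ A)) w + restrictTo c x (𝟙 ∘ A) w) v
        ≡⟨ deg-+ (λ w → suc d * restrictTo c x (𝟙 ∘ (U ∖ A)) w) (restrictTo c x (𝟙 ∘ A)) v ⟩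
      deg (λ w → suc d * restrictTo c x (𝟙 ∘ (U ∖ A)) w) v + colourDeg A c x v
        ≡⟨ cong (_+ colourDeg A c x v) (deg-*ˡ (suc d) (restrictTo c x (𝟙 ∘ (U ∖ A))) v) ⟩
      suc d * colourDeg (U ∖ A) c x v + colourDeg A c x v ∎
      where
      open ≡-Reasoning
      distrib : ∀ r b a → r * (suc d * b + a) ≡ suc d * (r * b) + r * a
      distrib = ring d
        where
        ring : ∀ d r b a → r * (suc d * b + a) ≡ suc d * (r * b) + r * a
        ring = solve-∀

    clash≤d⇒ : ∀ U A c v x → clash U A c v x ≤ d → colourDeg (U ∖ A) c x v ≡ 0 × colourDeg A c x v ≤ d
    clash≤d⇒ U A c v x settled = arith _ _ (≤-trans (≤-reflexive (sym (clash-split U A c v x))) settled)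
      where
      arith : ∀ o i → suc d * o + i ≤ d → o ≡ 0 × i ≤ d
      arith zero    i le = refl , ≤-trans (m≤n+m i (suc d * 0)) le
      arith (suc o) i le = ⊥-elim (<-irrefl refl (≤-trans (m≤m*n (suc d) (suc o)) (≤-trans (m≤m+n _ i) le)))

    module _ (U A : VSet n) where

      Fits : (Fin n → ℕ) → Fin n → ℕ → Set
      Fits c₀ w x = (T (A w) → x ∈ L w) × (A w ≡ false → x ≡ c₀ w)

      potentialWeight : Fin n → Fin n → ℕ
      potentialWeight u w = 𝟙 (A u) * (edge u w * (𝟙 (A w) + 2 * suc d * 𝟙 ((U ∖ A) w)))

      -- weighted so that recolouring a vertex of A changes the potential by twice the change of its clash
      potential : (Fin n → ℕ) → ℕ
      potential = pairSum potentialWeight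

      pairSumAt-potentialWeight : ∀ c v x → A v ≡ true → pairSumAt potentialWeight c v x ≡ 2 * clash U A c v x
      pairSumAt-potentialWeight c v x Av =
        trans (sumF-cong pointwise) (sumF-*ˡ 2 (λ w → edge v w * restrictTo c x (clashWeight U A) w))
        where
        ring : ∀ d e a b r → (1 * (e * (a + 2 * suc d * b)) + a * (e * (1 + 2 * suc d * 0))) * r
                             ≡ 2 * (e * (r * (suc d * b + a)))
        ring = solve-∀
        pointwise : ∀ w → (potentialWeight v w + potentialWeight w v) * 𝟙 ⌊ c w ≟ x ⌋
                          ≡ 2 * (edge v w * restrictTo c x (clashWeight U A) w)
        pointwise w rewrite Av | ∧-zeroʳ (U v) | Graph.sym G w v =
          ring d (edge v w) (𝟙 (A w)) (𝟙 ((U ∖ A) w)) (𝟙 ⌊ c w ≟ x ⌋)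

      potentialWeight-diag : ∀ v → potentialWeight v v ≡ 0
      potentialWeight-diag v rewrite irrefl G v = *-zeroʳ (𝟙 (A v))

      potential-decreases : ∀ c v β → A v ≡ true → clash U A c v β ≤ d → d < clash U A c v (c v) →
        potential (updateAt c v (const β)) < potential c
      potential-decreases c v β Av good bad = +-cancelʳ-< (2 * clash U A c v β) _ _ (begin-strict
        potential c′ + 2 * clash U A c v β
          <⟨ +-monoʳ-< (potential c′) (*-monoʳ-< 2 (≤-<-trans good bad)) ⟩
        potential c′ + 2 * clash U A c v (c v)
          ≡⟨ cong (potential c′ +_) (sym (pairSumAt-potentialWeight c v (c v) Av)) ⟩
        potential c′ + pairSumAt potentialWeight c v (c v)
          ≡⟨ pairSum-updateAt potentialWeight c v β (potentialWeight-diag v) ⟩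
        potential c + pairSumAt potentialWeight c v β
          ≡⟨ cong (potential c +_) (pairSumAt-potentialWeight c v β Av) ⟩
        potential c + 2 * clash U A c v β ∎)
        where
        open ≤-Reasoning
        c′ : Fin n → ℕ
        c′ = updateAt c v (const β)

      search : (∀ v → T (A v) → Light U A v) → ∀ c₀ fuel c → potential c < fuel → (∀ w → Fits c₀ w (c w)) →
        ∃ λ c′ → (∀ w → Fits c₀ w (c′ w)) × (∀ v → T (A v) → clash U A c′ v (c′ v) ≤ d)
      search light c₀ (suc fuel) c bound fits with any? (λ v → T? (A v) ×-dec (d <? clash U A c v (c v)))
      ... | no  allSettled = c , fits , λ v Av → ≮⇒≥ (λ unsettled → allSettled (v , Av , unsettled))
      ... | yes (v , Av , unsettled) with pickColour U A c v (light v Av)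
      ...   | β , β∈L , settled =
        search light c₀ fuel (updateAt c v (const β))
          (<-≤-trans (potential-decreases c v β (Equivalence.to T-≡ Av) settled unsettled) (s≤s⁻¹ bound))
          (updateAt-preserves (Fits c₀) c v β ((λ _ → β∈L) , λ Av≡false → ⊥-elim (subst T Av≡false Av))
                              fits)

      extend : ∀ {c₀ c} → GoodOn (U ∖ A) c₀ → (∀ w → Fits c₀ w (c w)) →
        (∀ v → T (A v) → clash U A c v (c v) ≤ d) → GoodOn U c
      extend {c₀} {c} good₀ fits settled v Uv with A v in Av
      ... | true  = proj₁ (fits v) (Equivalence.from T-≡ Av) , defect
        where
        open ≤-Reasoning
        split : colourDeg (U ∖ A) c (c v) v ≡ 0 × colourDeg A c (c v) v ≤ d
        split = clash≤d⇒ U A c v (c v) (settled v (Equivalence.from T-≡ Av))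
        U⊆A∪[U∖A] : ∀ w → restrictTo c (c v) (𝟙 ∘ U) w
                          ≤ restrictTo c (c v) (𝟙 ∘ A) w + restrictTo c (c v) (𝟙 ∘ (U ∖ A)) w
        U⊆A∪[U∖A] w with ⌊ c w ≟ c v ⌋ | U w | A w
        ... | false | _     | _     = z≤n
        ... | true  | false | _     = z≤n
        ... | true  | true  | true  = s≤s z≤n
        ... | true  | true  | false = s≤s z≤n
        defect : colourDeg U c (c v) v ≤ d
        defect = begin
          colourDeg U c (c v) v
            ≤⟨ deg-mono v (λ w _ → U⊆A∪[U∖A] w) ⟩
          deg (λ w → restrictTo c (c v) (𝟙 ∘ A) w + restrictTo c (c v) (𝟙 ∘ (U ∖ A)) w) v
            ≡⟨ deg-+ (restrictTo c (c v) (𝟙 ∘ A)) (restrictTo c (c v) (𝟙 ∘ (U ∖ A))) v ⟩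
          colourDeg A c (c v) v + colourDeg (U ∖ A) c (c v) v
            ≤⟨ +-mono-≤ (proj₂ split) (≤-reflexive (proj₁ split)) ⟩
          d + 0 ≡⟨ +-identityʳ d ⟩
          d ∎
      ... | false = subst (_∈ L v) (sym cv≡c₀v) (proj₁ good₀v)
                  , ≤-trans (deg-mono v pointwise) (proj₂ good₀v)
        where
        open ≤-Reasoning
        cv≡c₀v : c v ≡ c₀ v
        cv≡c₀v = proj₂ (fits v) Av
        good₀v : c₀ v ∈ L v × colourDeg (U ∖ A) c₀ (c₀ v) v ≤ d
        good₀v = good₀ v (Equivalence.from T-∧ (Uv , Equivalence.from T-not-≡ Av))
        -- a neighbour w in A sharing v's colour would have a neighbour in U ∖ A of its own colour
        pointwise : ∀ w → T (adj G v w) →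
                    restrictTo c (c v) (𝟙 ∘ U) w ≤ restrictTo c₀ (c₀ v) (𝟙 ∘ (U ∖ A)) w
        pointwise w vw with A w in Aw
        ... | false rewrite proj₂ (fits w) Aw | cv≡c₀v | ∧-identityʳ (U w) = ≤-refl
        ... | true with c w ≟ c v
        ...   | no  _     = z≤n
        ...   | yes cw≡cv = ⊥-elim (<-irrefl refl (begin-strict
          0                                           <⟨ s≤s z≤n ⟩
          1                                           ≡⟨ sym v-counts ⟩
          edge w v * restrictTo c (c w) (𝟙 ∘ (U ∖ A)) v
            ≤⟨ term≤sumF (λ u → edge w u * restrictTo c (c w) (𝟙 ∘ (U ∖ A)) u) v ⟩
          colourDeg (U ∖ A) c (c w) w
            ≡⟨ proj₁ (clash≤d⇒ U A c w (c w) (settled w (Equivalence.from T-≡ Aw))) ⟩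
          0 ∎))
          where
          v-counts : edge w v * restrictTo c (c w) (𝟙 ∘ (U ∖ A)) v ≡ 1
          v-counts rewrite Graph.sym G w v | Equivalence.to T-≡ vw | cw≡cv | ≟-diag (refl {x = c v})
                         | Equivalence.to T-≡ Uv | Av = refl

      extendColouring : k ≥ 1 → (∀ v → T (A v) → Light U A v) →
                        ∀ {c₀} → GoodOn (U ∖ A) c₀ → ∃ (GoodOn U)
      extendColouring k≥1 light {c₀} good₀ =
        let c , fits , settled = search light c₀ (suc (potential c₁)) c₁ ≤-refl fits₁
        in  c , extend good₀ fits settled
        where
        c₁ : Fin n → ℕ
        c₁ w = if A w then proj₁ (someColour k≥1 w) else c₀ w
        fits₁ : ∀ w → Fits c₀ w (c₁ w)
        fits₁ w with A w
        ... | true  = (λ _ → proj₂ (someColour k≥1 w)) , λ ()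
        ... | false = (λ ()) , λ _ → refl

    module _ (U : VSet n) where

      peelWeight : VSet n → ℕ
      peelWeight A = suc (suc d) * ⟨ 𝟙 ∘ A , 𝟙 ∘ A ⟩ + 2 * suc d * ⟨ 𝟙 ∘ A , 𝟙 ∘ (U ∖ A) ⟩

      peelWeight-whole : peelWeight U ≡ suc (suc d) * ⟨ 𝟙 ∘ U , 𝟙 ∘ U ⟩
      peelWeight-whole = begin
        suc (suc d) * ⟨ 𝟙 ∘ U , 𝟙 ∘ U ⟩ + 2 * suc d * ⟨ 𝟙 ∘ U , 𝟙 ∘ (U ∖ U) ⟩
          ≡⟨ cong (λ x → suc (suc d) * ⟨ 𝟙 ∘ U , 𝟙 ∘ U ⟩ + 2 * suc d * x) (⟨⟩-zeroʳ (𝟙 ∘ U) U∖U≡∅) ⟩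
        suc (suc d) * ⟨ 𝟙 ∘ U , 𝟙 ∘ U ⟩ + 2 * suc d * 0
          ≡⟨ cong (suc (suc d) * ⟨ 𝟙 ∘ U , 𝟙 ∘ U ⟩ +_) (*-zeroʳ (2 * suc d)) ⟩
        suc (suc d) * ⟨ 𝟙 ∘ U , 𝟙 ∘ U ⟩ + 0
          ≡⟨ +-identityʳ _ ⟩
        suc (suc d) * ⟨ 𝟙 ∘ U , 𝟙 ∘ U ⟩ ∎
        where
        open ≡-Reasoning
        U∖U≡∅ : ∀ w → 𝟙 ((U ∖ U) w) ≡ 0
        U∖U≡∅ w with U w
        ... | true  = refl
        ... | false = refl

      Dense : VSet n → Set
      Dense A = 2 * suc d * k * count A ≤ peelWeight A

      dense-remove : ∀ A v → U v ≡ true → A v ≡ true → suc d * k ≤ deg (clashWeight U A) v →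
        Dense (A - v) → Dense A
      dense-remove A v Uv Av violated dense′ = begin
        2 * suc d * k * count A             ≡⟨ cong (2 * suc d * k *_) (count-remove A v Av) ⟩
        2 * suc d * k * suc (count A′)      ≤⟨ arith (count A′) P Q a o dense″ violated′ ⟩
        suc (suc d) * (P + a + a) + 2 * suc d * (Q + o)
          ≡⟨ sym (cong₂ (λ x y → suc (suc d) * x + 2 * suc d * y) ⟨A,A⟩ ⟨A,B⟩) ⟩
        peelWeight A ∎
        where
        open ≤-Reasoning
        A′ : VSet n
        A′ = A - v
        P Q a o : ℕ
        P = ⟨ 𝟙 ∘ A′ , 𝟙 ∘ A′ ⟩
        Q = ⟨ 𝟙 ∘ A′ , 𝟙 ∘ (U ∖ A) ⟩
        a = deg (𝟙 ∘ A′) v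
        o = deg (𝟙 ∘ (U ∖ A)) v
        degA : deg (𝟙 ∘ A) v ≡ a
        degA = deg-δ-self v (𝟙-remove A v Av)
        ⟨A,A⟩ : ⟨ 𝟙 ∘ A , 𝟙 ∘ A ⟩ ≡ P + a + a
        ⟨A,A⟩ = begin-equality
          ⟨ 𝟙 ∘ A , 𝟙 ∘ A ⟩                  ≡⟨ ⟨⟩-δˡ v (𝟙 ∘ A) (𝟙-remove A v Av) ⟩
          ⟨ 𝟙 ∘ A′ , 𝟙 ∘ A ⟩ + deg (𝟙 ∘ A) v
            ≡⟨ cong₂ _+_ (⟨⟩-δʳ (𝟙 ∘ A′) v (𝟙-remove A v Av)) degA ⟩
          P + a + a ∎
        ⟨A,B⟩ : ⟨ 𝟙 ∘ A , 𝟙 ∘ (U ∖ A) ⟩ ≡ Q + o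
        ⟨A,B⟩ = ⟨⟩-δˡ v (𝟙 ∘ (U ∖ A)) (𝟙-remove A v Av)
        dense″ : 2 * suc d * k * count A′ ≤ suc (suc d) * P + 2 * suc d * (Q + a)
        dense″ = ≤-trans dense′ (≤-reflexive (cong (λ x → suc (suc d) * P + 2 * suc d * x)
                                                    (⟨⟩-δʳ (𝟙 ∘ A′) v (𝟙-∖-remove U A v Uv Av))))
        violated′ : suc d * k ≤ suc d * o + a
        violated′ = ≤-trans violated (≤-reflexive (trans (deg-clashWeight U A v) (cong (suc d * o +_) degA)))
        -- peelWeight A exceeds peelWeight (A - v) by 2 a + 2 (d + 1) o, which v's violation bounds below
        arith : ∀ c P Q a o → 2 * suc d * k * c ≤ suc (suc d) * P + 2 * suc d * (Q + a) →
                suc d * k ≤ suc d * o + a →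
                2 * suc d * k * suc c ≤ suc (suc d) * (P + a + a) + 2 * suc d * (Q + o)
        arith c P Q a o IH step = begin
          2 * suc d * k * suc c                           ≡⟨ lhs d k c ⟩
          2 * suc d * k * c + 2 * (suc d * k)              ≤⟨ +-mono-≤ IH (*-monoʳ-≤ 2 step) ⟩
          suc (suc d) * P + 2 * suc d * (Q + a) + 2 * (suc d * o + a)
                                                          ≡⟨ rhs d P Q a o ⟩
          suc (suc d) * (P + a + a) + 2 * suc d * (Q + o) ∎
          where
          lhs : ∀ d k c → 2 * suc d * k * suc c ≡ 2 * suc d * k * c + 2 * (suc d * k)
          lhs = solve-∀
          rhs : ∀ d P Q a o → suc (suc d) * P + 2 * suc d * (Q + a) + 2 * (suc d * o + a)
                              ≡ suc (suc d) * (P + a + a) + 2 * suc d * (Q + o)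
          rhs = solve-∀

      LightCore : Set
      LightCore = ∃ λ A → (∀ w → T (A w) → T (U w)) × (∃ λ v → T (A v))
                        × (∀ v → T (A v) → Light U A v)

      peel : ∀ fuel A → count A ≤ fuel → (∀ w → T (A w) → T (U w)) → LightCore ⊎ Dense A
      peel fuel A |A|≤fuel A⊆U with any? (λ v → T? (A v) ×-dec (suc d * k ≤? deg (clashWeight U A) v))
      peel zero A |A|≤0 A⊆U | yes (v , Av , _) = ⊥-elim (<-irrefl refl (≤-trans (count-pos A v Av) |A|≤0))
      peel (suc fuel) A |A|≤fuel A⊆U | yes (v , Av , violated)
        with peel fuel (A - v)
                  (s≤s⁻¹ (≤-trans (≤-reflexive (sym (count-remove A v (Equivalence.to T-≡ Av)))) |A|≤fuel))
                  (λ w → A⊆U w ∘ proj₁ ∘ Equivalence.to T-∧)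
      ... | inj₁ core   = inj₁ core
      ... | inj₂ dense′ =
        inj₂ (dense-remove A v (Equivalence.to T-≡ (A⊆U v Av)) (Equivalence.to T-≡ Av) violated dense′)
      peel fuel A _ A⊆U | no noneViolated with any? (T? ∘ A)
      ... | yes nonempty =
        inj₁ (A , A⊆U , nonempty , λ v Av → ≰⇒> (λ violated → noneViolated (v , Av , violated)))
      ... | no  empty    =
        inj₂ (≤-trans (≤-reflexive (trans (cong (2 * suc d * k *_) |A|≡0) (*-zeroʳ (2 * suc d * k)))) z≤n)
        where
        |A|≡0 : count A ≡ 0
        |A|≡0 = ¬T⇒count≡0 A (λ v Av → empty (v , Av))

    module _ (k≥1 : k ≥ 1) (mad : madLessThan G (mkℚᵘ (ℤ.+ ((2 * d + 2) * k)) (suc d))) where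

      mad⇒sparse : ∀ U {m} → count U ≡ suc m → suc (suc d) * ⟨ 𝟙 ∘ U , 𝟙 ∘ U ⟩ < 2 * suc d * k * count U
      mad⇒sparse U {m} |U|≡1+m with mad (induced U) m |U|≡1+m
      ... | *<* avg<bound = begin-strict
        suc (suc d) * ⟨ 𝟙 ∘ U , 𝟙 ∘ U ⟩  ≡⟨ *-comm (suc (suc d)) ⟨ 𝟙 ∘ U , 𝟙 ∘ U ⟩ ⟩
        ⟨ 𝟙 ∘ U , 𝟙 ∘ U ⟩ * suc (suc d)  ≡⟨ cong (_* suc (suc d)) (sym (degreeSum-induced U)) ⟩
        degreeSum * suc (suc d)          <⟨ ℤ.drop‿+<+ (subst₂ ℤ._<_ (sym (ℤ.pos-* degreeSum (suc (suc d))))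
                                                                   (sym (ℤ.pos-* ((2 * d + 2) * k) (suc m)))
                                                                   avg<bound) ⟩
        (2 * d + 2) * k * suc m          ≡⟨ ring d k m ⟩
        2 * suc d * k * suc m            ≡⟨ cong (2 * suc d * k *_) (sym |U|≡1+m) ⟩
        2 * suc d * k * count U ∎
        where
        open ≤-Reasoning
        degreeSum : ℕ
        degreeSum = sumF (λ v → if U v then degH (induced U) v else 0)
        ring : ∀ d k m → (2 * d + 2) * k * suc m ≡ 2 * suc d * k * suc m
        ring = solve-∀

      dense⇒empty : ∀ U → Dense U U → count U ≡ 0
      dense⇒empty U dense = by-cases (count U) refl
        where
        by-cases : ∀ x → count U ≡ x → count U ≡ 0
        by-cases zero    |U|≡0   = |U|≡0
        by-cases (suc m) |U|≡1+m =
          ⊥-elim (<⇒≱ (mad⇒sparse U |U|≡1+m) (≤-trans dense (≤-reflexive (peelWeight-whole U))))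

      vacuous : ∀ U → count U ≡ 0 → ∀ c → GoodOn U c
      vacuous U |U|≡0 c v Uv = ⊥-elim (count≡0⇒¬T U |U|≡0 v Uv)

      colourSubset : ∀ fuel U → count U ≤ fuel → ∃ (GoodOn U)
      colourSubset zero       U |U|≤0    = const 0 , vacuous U (n≤0⇒n≡0 |U|≤0) (const 0)
      colourSubset (suc fuel) U |U|≤fuel with peel U (count U) U ≤-refl (λ _ Uw → Uw)
      ... | inj₂ dense = const 0 , vacuous U (dense⇒empty U dense) (const 0)
      ... | inj₁ (A , A⊆U , (v , Av) , light) =
        extendColouring U A k≥1 light
          (proj₂ (colourSubset fuel (U ∖ A) (s≤s⁻¹ (≤-trans smaller |U|≤fuel))))
        where
        open ≤-Reasoning
        smaller : suc (count (U ∖ A)) ≤ count U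
        smaller = begin
          suc (count (U ∖ A))       ≡⟨ +-comm 1 (count (U ∖ A)) ⟩
          count (U ∖ A) + 1         ≤⟨ +-monoʳ-≤ (count (U ∖ A)) (count-pos A v Av) ⟩
          count (U ∖ A) + count A   ≡⟨ sym (count-∖ U A A⊆U) ⟩
          count U ∎

open import Data.Integer using (+_)

theorem2 : (d k : ℕ) → k ≥ 1 → (n : ℕ) (G : Graph n) →
    madLessThan G (mkℚᵘ (+ ((2 * d + 2) * k)) (suc d)) →
    ChoosableDefect G k d
theorem2 d k k≥1 n G mad (L , L-ok)
  with colourSubset G d k L L-ok k≥1 mad (count {n} (const true)) (const true) ≤-refl
... | c , good = c , λ v → proj₁ (good v _)
                         , ≤-trans (≤-reflexive (monoDeg≡colourDeg G d k L L-ok c v)) (proj₂ (good v _))
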